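{- For every integer $n > 1$, stit logic does not have the Strong $n$-Craig Interpolation Property $(SCIP)_n$; that is, it is not the case that for every set of propositional variables $V$ and all $A, B \in \mathcal{L}^{\{1,\ldots,n\}}_V$ with $\vdash A \to B$ there exists $C \in \mathcal{L}^{Ag(A)\cap Ag(B)}_{|A|\cap|B|}$ with both $\vdash A \to C$ and $\vdash C \to B$.
   Context: For a finite set $Ag$ of agent indices (possibly empty) and a set $V$ of propositional variables, $\mathcal{L}^{Ag}_V$ is the set of stit formulas given by $A ::= p \mid A \to A \mid \bot \mid \Box A \mid [j]A$ with $p \in V$, $j \in Ag$ (other Boolean connectives defined as usual; $\Diamond A := \neg\Box\neg A$). $\vdash A$ means derivability in the axiom system $\mathbb{S}$ with axioms: all classical propositional tautologies; S5 axioms for $\Box$ and for each $[j]$; $\Box A \to [j]A$; and $(\Diamond[j_1]A_1 \wedge\dots\wedge \Diamond[j_k]A_k) \to \Diamond([j_1]A_1\wedge\dots\wedge[j_k]A_k)$ for pairwise distinct $j_1,\dots,j_k$; rules: modus ponens and necessitation for $\Box$. For a formula $A$, $|A|$ is the set of propositional variables occurring in $A$ and $Ag(A)$ the set of agent indices occurring in $A$. -}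

module Defs where

open import Data.Nat using (ℕ)
open import Data.Fin using (Fin)
open import Data.Bool using (Bool; true; false; not; _∨_)
open import Data.Product using (_×_; proj₁)
open import Data.List using (List; []; _∷_)
open import Data.List.NonEmpty using (List⁺; _∷_; toList)
import Data.List.NonEmpty as L⁺
open import Data.List.Relation.Unary.Unique.Propositional using (Unique)
open import Relation.Binary.PropositionalEquality using (_≡_)

-- Stit formulas over variables V and agent indices Fin n
-- (agents {1,…,n} are represented by Fin n = {0,…,n-1}).
infixr 5 _⇒_
data Form (V : Set) (n : ℕ) : Set where
  var  : V → Form V n
  _⇒_  : Form V n → Form V n → Form V n
  ⊥'   : Form V n
  □    : Form V n → Form V n
  [_]_ : Fin n → Form V n → Form V n

module _ {V : Set} {n : ℕ} where

  ¬' : Form V n → Form V n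
  ¬' A = A ⇒ ⊥'

  _∧'_ : Form V n → Form V n → Form V n
  A ∧' B = ¬' (A ⇒ ¬' B)

  ◇ : Form V n → Form V n
  ◇ A = ¬' (□ (¬' A))

  ⋀' : Form V n → List (Form V n) → Form V n
  ⋀' A []       = A
  ⋀' A (B ∷ Bs) = A ∧' ⋀' B Bs

  ⋀ : List⁺ (Form V n) → Form V n
  ⋀ (A ∷ As) = ⋀' A As

  -- classical truth evaluation, treating variables and modal formulas as atoms
  eval : (Form V n → Bool) → Form V n → Bool
  eval v (var p)   = v (var p)
  eval v (A ⇒ B)   = not (eval v A) ∨ eval v B
  eval v ⊥'        = false
  eval v (□ A)     = v (□ A)
  eval v ([ j ] A) = v ([ j ] A)

  Taut : Form V n → Set
  Taut A = (v : Form V n → Bool) → eval v A ≡ true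

  data ⊢_ : Form V n → Set where
    taut : ∀ {A} → Taut A → ⊢ A
    K□ : ∀ A B → ⊢ (□ (A ⇒ B) ⇒ □ A ⇒ □ B)
    T□ : ∀ A → ⊢ (□ A ⇒ A)
    4□ : ∀ A → ⊢ (□ A ⇒ □ (□ A))
    5□ : ∀ A → ⊢ (◇ A ⇒ □ (◇ A))
    K[] : ∀ j A B → ⊢ ([ j ] (A ⇒ B) ⇒ [ j ] A ⇒ [ j ] B)
    T[] : ∀ j A → ⊢ ([ j ] A ⇒ A)
    4[] : ∀ j A → ⊢ ([ j ] A ⇒ [ j ] ([ j ] A))
    5[] : ∀ j A → ⊢ (¬' ([ j ] (¬' A)) ⇒ [ j ] (¬' ([ j ] (¬' A))))
    □[] : ∀ j A → ⊢ (□ A ⇒ [ j ] A)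
    AIA : (js : List⁺ (Fin n × Form V n)) →
          Unique (toList (L⁺.map proj₁ js)) →
          ⊢ (⋀ (L⁺.map (λ x → ◇ ([ proj₁ x ] Data.Product.proj₂ x)) js)
              ⇒ ◇ (⋀ (L⁺.map (λ x → [ proj₁ x ] Data.Product.proj₂ x) js)))
    mp  : ∀ {A B} → ⊢ (A ⇒ B) → ⊢ A → ⊢ B
    nec : ∀ {A} → ⊢ A → ⊢ □ A

  data VarIn (p : V) : Form V n → Set where
    here : VarIn p (var p)
    ⇒ˡ   : ∀ {A B} → VarIn p A → VarIn p (A ⇒ B)
    ⇒ʳ   : ∀ {A B} → VarIn p B → VarIn p (A ⇒ B)
    □-   : ∀ {A} → VarIn p A → VarIn p (□ A)
    []-  : ∀ {j A} → VarIn p A → VarIn p ([ j ] A)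

  data AgIn (j : Fin n) : Form V n → Set where
    here : ∀ {A} → AgIn j ([ j ] A)
    ⇒ˡ   : ∀ {A B} → AgIn j A → AgIn j (A ⇒ B)
    ⇒ʳ   : ∀ {A B} → AgIn j B → AgIn j (A ⇒ B)
    □-   : ∀ {A} → AgIn j A → AgIn j (□ A)
    []-  : ∀ {k A} → AgIn j A → AgIn j ([ k ] A)

  InCommonLang : Form V n → Form V n → Form V n → Set
  InCommonLang A B C =
    ((p : V) → VarIn p C → VarIn p A × VarIn p B) ×
    ((j : Fin n) → AgIn j C → AgIn j A × AgIn j B)

SCIP : ℕ → Set₁
SCIP n = (V : Set) (A B : Form V n) → ⊢ (A ⇒ B) →
         Data.Product.Σ (Form V n) λ C →
           InCommonLang A B C × ⊢ (A ⇒ C) × ⊢ (C ⇒ B)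

-- Take A = ◇[0]¬p and B = ¬[1]p. Independence of agents gives ⊢ A → B,
-- while A and B share no agent, so an interpolant C would contain no
-- agent at all. Consider one moment with two histories, p true exactly on
-- the first, in which a single agent a can separate the histories and all
-- other agents are powerless. Both choices a = 0 and a = 1 yield models of 𝕊,
-- and they agree on agent-free formulas. With a = 0, A and hence C hold on
-- the first history; with a = 1, C still holds there but B fails.
module Submission where

open import Defs
open import Data.Bool using (Bool; true; false; not; _∨_; _∧_; T; if_then_else_)
open import Data.Bool.Properties using (T-∧; ∧-zeroʳ)
open import Data.Empty using (⊥-elim)
open import Data.Fin using (Fin; _≟_) renaming (zero to 0F; suc to sucF)
open import Data.List using (List; []; _∷_; map)
open import Data.List.NonEmpty using (_∷_; toList)
import Data.List.NonEmpty as List⁺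
open import Data.List.Relation.Unary.All as All using (All; []; _∷_)
open import Data.List.Relation.Unary.All.Properties using (map⁺; map⁻)
open import Data.List.Relation.Unary.AllPairs using ([]; _∷_)
open import Data.List.Relation.Unary.Unique.Propositional using (Unique)
open import Data.Nat using (ℕ; _<_; zero; suc; s≤s; z≤n)
open import Data.Product using (Σ; ∃; _×_; _,_; proj₁; proj₂)
open import Data.Unit using (⊤; tt)
open import Function using (_∘_)
open import Function.Bundles using (Equivalence)
open import Relation.Nullary using (¬_; Dec; yes; no)
open import Relation.Binary.PropositionalEquality
  using (_≡_; _≢_; refl; sym; trans; subst; cong; cong₂)

BoolFun : ℕ → Set
BoolFun zero    = Bool
BoolFun (suc k) = Bool → BoolFun k

Tautology : ∀ k → BoolFun k → Set
Tautology zero    b = b ≡ true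
Tautology (suc k) f = ∀ x → Tautology k (f x)

allRows : ∀ k → BoolFun k → Bool
allRows zero    b = b
allRows (suc k) f = allRows k (f true) ∧ allRows k (f false)

tautology-by-table : ∀ k (f : BoolFun k) → T (allRows k f) → Tautology k f
tautology-by-table zero    true  _ = refl
tautology-by-table (suc k) f     t true  =
  tautology-by-table k (f true)  (proj₁ (Equivalence.to T-∧ t))
tautology-by-table (suc k) f     t false =
  tautology-by-table k (f false) (proj₂ (Equivalence.to (T-∧ {allRows k (f true)}) t))

infixr 5 _⇒ᵇ_

_⇒ᵇ_ : Bool → Bool → Bool
x ⇒ᵇ y = not x ∨ y

¬ᵇ : Bool → Bool
¬ᵇ x = x ⇒ᵇ false

⇒ᵇ-intro : ∀ x y → (x ≡ true → y ≡ true) → x ⇒ᵇ y ≡ true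
⇒ᵇ-intro false y _ = refl
⇒ᵇ-intro true  y f = f refl

⇒ᵇ-elim : ∀ {x y} → x ⇒ᵇ y ≡ true → x ≡ true → y ≡ true
⇒ᵇ-elim e refl = e

⇒ᵇ-refl : ∀ x → x ⇒ᵇ x ≡ true
⇒ᵇ-refl x = ⇒ᵇ-intro x x (λ e → e)

∧ᵇ-intro : ∀ {x y} → x ≡ true → y ≡ true → ¬ᵇ (x ⇒ᵇ ¬ᵇ y) ≡ true
∧ᵇ-intro refl refl = refl

∧ᵇ-elim : ∀ x y → ¬ᵇ (x ⇒ᵇ ¬ᵇ y) ≡ true → x ≡ true × y ≡ true
∧ᵇ-elim true  true  _ = refl , refl
∧ᵇ-elim true  false ()
∧ᵇ-elim false _     ()

Prop : Set
Prop = Bool → Bool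

Modality : Set
Modality = Prop → Prop

□ᵇ : Modality
□ᵇ f _ = f true ∧ f false

◇ᵇ : Modality
◇ᵇ f w = ¬ᵇ (□ᵇ (λ u → ¬ᵇ (f u)) w)

◇ᵇ-intro : ∀ f u w → f u ≡ true → ◇ᵇ f w ≡ true
◇ᵇ-intro f true  w e rewrite e = refl
◇ᵇ-intro f false w e rewrite e | ∧-zeroʳ (¬ᵇ (f true)) = refl

◇ᵇ-elim : ∀ f w → ◇ᵇ f w ≡ true → ∃ λ u → f u ≡ true
◇ᵇ-elim f w e with f true in e₁ | f false in e₀
... | true  | _    = true  , e₁
... | false | true = false , e₀
◇ᵇ-elim f w () | false | false

Distrib : Modality → Prop → Prop → Bool → Bool
Distrib M f g w = M (λ u → f u ⇒ᵇ g u) w ⇒ᵇ (M f w ⇒ᵇ M g w)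

Reflexive : Modality → Prop → Bool → Bool
Reflexive M f w = M f w ⇒ᵇ f w

Transitive : Modality → Prop → Bool → Bool
Transitive M f w = M f w ⇒ᵇ M (M f) w

Euclidean : Modality → Prop → Bool → Bool
Euclidean M f w = ¬ᵇ (M (λ u → ¬ᵇ (f u)) w) ⇒ᵇ M (λ u → ¬ᵇ (M (λ u′ → ¬ᵇ (f u′)) u)) w

record IsS5 (M : Modality) : Set where
  field
    distrib    : ∀ f g w → Distrib M f g w ≡ true
    reflexive  : ∀ f w → Reflexive M f w ≡ true
    transitive : ∀ f w → Transitive M f w ≡ true
    euclidean  : ∀ f w → Euclidean M f w ≡ true

id-isS5 : IsS5 (λ f → f)
id-isS5 = record
  { distrib    = λ f g w → ⇒ᵇ-refl (f w ⇒ᵇ g w)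
  ; reflexive  = λ f w → ⇒ᵇ-refl (f w)
  ; transitive = λ f w → ⇒ᵇ-refl (f w)
  ; euclidean  = λ f w → ⇒ᵇ-refl (¬ᵇ (¬ᵇ (f w)))
  }

-- □ᵇ applies a proposition f only to true and false, so f may be replaced by
-- tabulate (f true) (f false) and every law becomes a truth table.
□ᵇ-isS5 : IsS5 □ᵇ
□ᵇ-isS5 = record
  { distrib    = λ f g w → tautology-by-table 4
      (λ f₁ f₀ g₁ g₀ → Distrib □ᵇ (tabulate f₁ f₀) (tabulate g₁ g₀) w) tt
      (f true) (f false) (g true) (g false)
  ; reflexive  = reflexive
  ; transitive = λ f w → tautology-by-table 2
      (λ f₁ f₀ → Transitive □ᵇ (tabulate f₁ f₀) w) tt (f true) (f false)
  ; euclidean  = λ f w → tautology-by-table 2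
      (λ f₁ f₀ → Euclidean □ᵇ (tabulate f₁ f₀) w) tt (f true) (f false)
  }
  where
  tabulate : Bool → Bool → Prop
  tabulate f₁ f₀ u = if u then f₁ else f₀

  reflexive : ∀ f w → Reflexive □ᵇ f w ≡ true
  reflexive f w@true  = tautology-by-table 2
    (λ f₁ f₀ → Reflexive □ᵇ (tabulate f₁ f₀) w) tt (f true) (f false)
  reflexive f w@false = tautology-by-table 2
    (λ f₁ f₀ → Reflexive □ᵇ (tabulate f₁ f₀) w) tt (f true) (f false)

-- One moment with the two histories true and false. Agent a's choice
-- separates them; every other agent has the single choice cell {true, false}.
module TwoHistoryModel {V : Set} {n : ℕ} (val : V → Bool → Bool) (a : Fin n) where

  choiceCell : ∀ {j} → Dec (j ≡ a) → Modality
  choiceCell (yes _) = λ f → f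
  choiceCell (no _)  = □ᵇ

  choiceCell-isS5 : ∀ {j} (j≟a : Dec (j ≡ a)) → IsS5 (choiceCell j≟a)
  choiceCell-isS5 (yes _) = id-isS5
  choiceCell-isS5 (no _)  = □ᵇ-isS5

  ⟦_⟧ : Form V n → Prop
  ⟦ var q ⟧   w = val q w
  ⟦ A ⇒ B ⟧   w = ⟦ A ⟧ w ⇒ᵇ ⟦ B ⟧ w
  ⟦ ⊥' ⟧      w = false
  ⟦ □ A ⟧     w = □ᵇ ⟦ A ⟧ w
  ⟦ [ j ] A ⟧ w = choiceCell (j ≟ a) ⟦ A ⟧ w

  eval-⟦⟧ : ∀ w A → eval (λ B → ⟦ B ⟧ w) A ≡ ⟦ A ⟧ w
  eval-⟦⟧ w (var q)   = refl
  eval-⟦⟧ w (A ⇒ B)   = cong₂ _⇒ᵇ_ (eval-⟦⟧ w A) (eval-⟦⟧ w B)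
  eval-⟦⟧ w ⊥'        = refl
  eval-⟦⟧ w (□ A)     = refl
  eval-⟦⟧ w ([ j ] A) = refl

  HoldsAt : Bool → Form V n → Set
  HoldsAt w A = ⟦ A ⟧ w ≡ true

  ⋀'-holds⁻ : ∀ {w} A As → HoldsAt w (⋀' A As) → All (HoldsAt w) (A ∷ As)
  ⋀'-holds⁻     A []       h = h ∷ []
  ⋀'-holds⁻ {w} A (B ∷ Bs) h =
    let hA , hBs = ∧ᵇ-elim (⟦ A ⟧ w) (⟦ ⋀' B Bs ⟧ w) h in hA ∷ ⋀'-holds⁻ B Bs hBs

  ⋀'-holds⁺ : ∀ {w} A As → All (HoldsAt w) (A ∷ As) → HoldsAt w (⋀' A As)
  ⋀'-holds⁺ A []       (h ∷ []) = h
  ⋀'-holds⁺ A (B ∷ Bs) (h ∷ hs) = ∧ᵇ-intro h (⋀'-holds⁺ B Bs hs)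

  []-constant : ∀ {j} A → j ≢ a → ∀ {u u′} → HoldsAt u ([ j ] A) → HoldsAt u′ ([ j ] A)
  []-constant {j} A j≢a {u} {u′} = subst (_≡ true) (cellConstant (j ≟ a))
    where
    cellConstant : (j≟a : Dec (j ≡ a)) → choiceCell j≟a ⟦ A ⟧ u ≡ choiceCell j≟a ⟦ A ⟧ u′
    cellConstant (yes j≡a) = ⊥-elim (j≢a j≡a)
    cellConstant (no _)    = refl

  [a]-trivial : ∀ A w → ⟦ [ a ] A ⟧ w ≡ ⟦ A ⟧ w
  [a]-trivial A w = cellSelf (a ≟ a)
    where
    cellSelf : (a≟a : Dec (a ≡ a)) → choiceCell a≟a ⟦ A ⟧ w ≡ ⟦ A ⟧ w
    cellSelf (yes _)  = refl
    cellSelf (no a≢a) = ⊥-elim (a≢a refl)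

  Stit : Fin n × Form V n → Form V n
  Stit x = [ proj₁ x ] proj₂ x

  stits-constant : ∀ L → All (λ x → a ≢ proj₁ x) L →
                   ∀ {u u′} → All (HoldsAt u ∘ Stit) L → All (HoldsAt u′ ∘ Stit) L
  stits-constant []            []           []       = []
  stits-constant ((j , A) ∷ L) (a≢j ∷ a∉L) (h ∷ hs) =
    []-constant A (a≢j ∘ sym) h ∷ stits-constant L a∉L hs

  -- Only agent a's stit formulas vary between histories, and among pairwise
  -- distinct agents at most one is a.
  independence : ∀ L → Unique (map proj₁ L) →
                 All (λ x → ∃ λ u → HoldsAt u (Stit x)) L →
                 ∃ λ u → All (HoldsAt u ∘ Stit) L
  independence []            _               _              = true , []
  independence ((j , A) ∷ L) (j∉L ∷ distinct) ((u , h) ∷ hs)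
    with independence L distinct hs | a ≟ j
  ... | u′ , hs′ | no a≢j   = u′ , []-constant A (a≢j ∘ sym) h ∷ hs′
  ... | u′ , hs′ | yes refl = u , h ∷ stits-constant L (map⁻ j∉L) hs′

  sound : ∀ {A} → ⊢ A → ∀ w → HoldsAt w A
  sound (taut {A} t)  w = trans (sym (eval-⟦⟧ w A)) (t (λ B → ⟦ B ⟧ w))
  sound (K□ A B)      w = IsS5.distrib □ᵇ-isS5 ⟦ A ⟧ ⟦ B ⟧ w
  sound (T□ A)        w = IsS5.reflexive □ᵇ-isS5 ⟦ A ⟧ w
  sound (4□ A)        w = IsS5.transitive □ᵇ-isS5 ⟦ A ⟧ w
  sound (5□ A)        w = IsS5.euclidean □ᵇ-isS5 ⟦ A ⟧ w
  sound (K[] j A B)   w = IsS5.distrib (choiceCell-isS5 (j ≟ a)) ⟦ A ⟧ ⟦ B ⟧ w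
  sound (T[] j A)     w = IsS5.reflexive (choiceCell-isS5 (j ≟ a)) ⟦ A ⟧ w
  sound (4[] j A)     w = IsS5.transitive (choiceCell-isS5 (j ≟ a)) ⟦ A ⟧ w
  sound (5[] j A)     w = IsS5.euclidean (choiceCell-isS5 (j ≟ a)) ⟦ A ⟧ w
  sound (□[] j A)     w with j ≟ a
  ... | yes _ = IsS5.reflexive □ᵇ-isS5 ⟦ A ⟧ w
  ... | no  _ = ⇒ᵇ-refl (□ᵇ ⟦ A ⟧ w)
  sound (AIA js distinct) w = ⇒ᵇ-intro _ _ λ h →
    let diamonds = map⁻ (⋀'-holds⁻ _ _ h)
        u , hs   = independence (toList js) distinct
                     (All.map (λ {x} → ◇ᵇ-elim ⟦ Stit x ⟧ w) diamonds)
    in ◇ᵇ-intro ⟦ ⋀ (List⁺.map Stit js) ⟧ u w (⋀'-holds⁺ _ _ (map⁺ hs))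
  sound (mp d e) w = ⇒ᵇ-elim (sound d w) (sound e w)
  sound (nec d)  w = cong₂ _∧_ (sound d true) (sound d false)

AgentFree : ∀ {V n} → Form V n → Set
AgentFree C = ∀ j → ¬ AgIn j C

⟦⟧-agentFree : ∀ {V n} (val : V → Bool → Bool) (a b : Fin n) C → AgentFree C →
               ∀ w → TwoHistoryModel.⟦_⟧ val a C w ≡ TwoHistoryModel.⟦_⟧ val b C w
⟦⟧-agentFree val a b (var q)   free w = refl
⟦⟧-agentFree val a b (A ⇒ B)   free w =
  cong₂ _⇒ᵇ_ (⟦⟧-agentFree val a b A (λ j → free j ∘ ⇒ˡ) w)
             (⟦⟧-agentFree val a b B (λ j → free j ∘ ⇒ʳ) w)
⟦⟧-agentFree val a b ⊥'        free w = refl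
⟦⟧-agentFree val a b (□ A)     free w =
  cong₂ _∧_ (⟦⟧-agentFree val a b A (λ j → free j ∘ □-) true)
            (⟦⟧-agentFree val a b A (λ j → free j ∘ □-) false)
⟦⟧-agentFree val a b ([ j ] A) free w = ⊥-elim (free j here)

◇[i]¬⇒¬[j] : ∀ {V n} {i j : Fin n} → i ≢ j → (P : Form V n) →
             ⊢ (◇ ([ i ] ¬' P) ⇒ ¬' ([ j ] P))
◇[i]¬⇒¬[j] {i = i} {j} i≢j P =
  mp (mp (mp (taut conclude) (T□ (¬' Y))) jointlyPossible) (nec incompatible)
  where
  X = [ i ] ¬' P
  Y = [ j ] P

  jointlyPossible : ⊢ (◇ X ∧' ◇ Y ⇒ ◇ (X ∧' Y))
  jointlyPossible = AIA ((i , ¬' P) ∷ (j , P) ∷ []) ((i≢j ∷ []) ∷ [] ∷ [])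

  incompatible : ⊢ ¬' (X ∧' Y)
  incompatible = mp (mp (taut contrary) (T[] i (¬' P))) (T[] j P)
    where
    contrary : Taut ((X ⇒ ¬' P) ⇒ (Y ⇒ P) ⇒ ¬' (X ∧' Y))
    contrary v = tautology-by-table 3
      (λ x y p → (x ⇒ᵇ ¬ᵇ p) ⇒ᵇ (y ⇒ᵇ p) ⇒ᵇ ¬ᵇ (¬ᵇ (x ⇒ᵇ ¬ᵇ y))) tt
      (eval v X) (eval v Y) (eval v P)

  conclude : Taut ((□ (¬' Y) ⇒ ¬' Y) ⇒ (◇ X ∧' ◇ Y ⇒ ◇ (X ∧' Y)) ⇒
                    □ (¬' (X ∧' Y)) ⇒ ◇ X ⇒ ¬' Y)
  conclude v = tautology-by-table 4
    (λ □¬y y □¬x □¬z → (□¬y ⇒ᵇ ¬ᵇ y) ⇒ᵇ (¬ᵇ (¬ᵇ □¬x ⇒ᵇ ¬ᵇ (¬ᵇ □¬y)) ⇒ᵇ ¬ᵇ □¬z) ⇒ᵇ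
                       □¬z ⇒ᵇ ¬ᵇ □¬x ⇒ᵇ ¬ᵇ y) tt
    (eval v (□ (¬' Y))) (eval v Y) (eval v (□ (¬' X))) (eval v (□ (¬' (X ∧' Y))))

AgIn-◇[]¬var : ∀ {V n} {k i : Fin n} {q : V} → AgIn k (◇ ([ i ] ¬' (var q))) → k ≡ i
AgIn-◇[]¬var (⇒ˡ (□- (⇒ˡ here))) = refl
AgIn-◇[]¬var (⇒ˡ (□- (⇒ˡ ([]- (⇒ˡ ())))))
AgIn-◇[]¬var (⇒ˡ (□- (⇒ˡ ([]- (⇒ʳ ())))))
AgIn-◇[]¬var (⇒ˡ (□- (⇒ʳ ())))
AgIn-◇[]¬var (⇒ʳ ())

AgIn-¬[]var : ∀ {V n} {k j : Fin n} {q : V} → AgIn k (¬' ([ j ] var q)) → k ≡ j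
AgIn-¬[]var (⇒ˡ here)      = refl
AgIn-¬[]var (⇒ˡ ([]- ()))
AgIn-¬[]var (⇒ʳ ())

holdsOnTrue : ⊤ → Bool → Bool
holdsOnTrue _ w = w

no-interpolant : ∀ {n} {i j : Fin n} → i ≢ j →
  let A = ◇ ([ i ] ¬' (var tt))
      B = ¬' ([ j ] var tt)
  in ¬ Σ (Form ⊤ n) λ C → InCommonLang A B C × ⊢ (A ⇒ C) × ⊢ (C ⇒ B)
no-interpolant {i = i} {j} i≢j (C , (_ , sharedAgents) , ⊢A⇒C , ⊢C⇒B) =
  false≢true (trans (sym B-failsⱼ) (⇒ᵇ-elim (Mⱼ.sound ⊢C⇒B true) C-holdsⱼ))
  where
  module Mᵢ = TwoHistoryModel holdsOnTrue i
  module Mⱼ = TwoHistoryModel holdsOnTrue j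

  false≢true : false ≢ true
  false≢true ()

  agentFree : AgentFree C
  agentFree k k∈C with sharedAgents k k∈C
  ... | k∈A , k∈B = i≢j (trans (sym (AgIn-◇[]¬var k∈A)) (AgIn-¬[]var k∈B))

  C-holdsᵢ : Mᵢ.HoldsAt true C
  C-holdsᵢ = ⇒ᵇ-elim (Mᵢ.sound ⊢A⇒C true)
    (◇ᵇ-intro Mᵢ.⟦ [ i ] ¬' (var tt) ⟧ false true (Mᵢ.[a]-trivial (¬' (var tt)) false))

  C-holdsⱼ : Mⱼ.HoldsAt true C
  C-holdsⱼ = trans (sym (⟦⟧-agentFree holdsOnTrue i j C agentFree true)) C-holdsᵢ

  B-failsⱼ : Mⱼ.⟦ ¬' ([ j ] var tt) ⟧ true ≡ false
  B-failsⱼ = cong ¬ᵇ (Mⱼ.[a]-trivial (var tt) true)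

theorem5 : (n : ℕ) → 1 < n → ¬ SCIP n
theorem5 (suc (suc _)) (s≤s (s≤s z≤n)) scip =
  no-interpolant 0≢1 (scip ⊤ _ _ (◇[i]¬⇒¬[j] 0≢1 (var tt)))
  where
  0≢1 : 0F ≢ sucF 0F
  0≢1 ()
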